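{- Let $d\ge1$, $k\ge 2$, $h\ge2$ and $1\le j\le h-1$ be integers. There exist a constant $c=c(d,k,h,j)>0$ and $n_0$ such that for all $n\ge n_0$ and any two disjoint subsets $A_1,A_2\subseteq[n]^d$ with $|A_1|,|A_2|\ge n^{\frac{k-1}{k}d}\log n$, $$f_{d,k,h,j}(A_1,A_2)\ge c\,\frac{1}{n^{d(k-1)}}|A_1|^{kj}|A_2|^{k(h-j)}.$$
   Context: $[n]^d$ is the set of vectors in $\mathbb{Z}^d$ with all coordinates in $\{1,\dots,n\}$, with coordinatewise addition. For disjoint $A_1,A_2\subseteq[n]^d$ and $j\in[h-1]$, $f_{d,k,h,j}(A_1,A_2)$ is the number of distinct $kh$-element sets $\{x_{\ell,i}:\ell\in[k],i\in[h]\}$ (the $x_{\ell,i}$ pairwise distinct) with $\{x_{\ell,i}:\ell\in[k],1\le i\le j\}\subseteq A_1$, $\{x_{\ell,i}:\ell\in[k],j+1\le i\le h\}\subseteq A_2$, and $\sum_{i=1}^h x_{1,i}=\sum_{i=1}^h x_{2,i}=\cdots=\sum_{i=1}^h x_{k,i}$. Logarithms are base 2. -}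

module Defs where

open import Data.Nat using (ℕ; zero; suc; _+_; _*_; _∸_; _^_; _≤_; _<_)
open import Data.Fin using (Fin; toℕ) renaming (zero to fz; suc to fs)
open import Data.Vec using (Vec; replicate; zipWith)
open import Data.Vec.Relation.Unary.All as VAll using ()
open import Data.List using (List; length)
open import Data.List.Membership.Propositional using (_∈_; _∉_)
open import Data.Product using (Σ; ∃; _×_)
open import Function using (_∘_)
open import Function.Bundles using (_⇔_)
open import Relation.Binary.PropositionalEquality using (_≡_)

-- A point of ℤ^d (we only use points with natural coordinates).
Point : ℕ → Set
Point d = Vec ℕ d

InGrid : ∀ {d} → ℕ → Point d → Set
InGrid n p = VAll.All (λ c → (1 ≤ c) × (c ≤ n)) p

rowSum : ∀ {d h} → (Fin h → Point d) → Point d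
rowSum {d} {zero}  x = replicate d 0
rowSum {d} {suc h} x = zipWith _+_ (x fz) (rowSum (x ∘ fs))

-- a labelled family x_{ℓ,i}, ℓ ∈ [k], i ∈ [h]  (0-based indices)
Config : ℕ → ℕ → ℕ → Set
Config k h d = Fin k → Fin h → Point d

-- the family is admissible for f_{d,k,h,j}(A₁,A₂):
-- pairwise distinct, x_{ℓ,i} ∈ A₁ for i ≤ j (1-based), ∈ A₂ for i > j,
-- and all row sums equal.
Admissible : ∀ {d} k h → ℕ → List (Point d) → List (Point d) → Config k h d → Set
Admissible k h j A₁ A₂ x =
  (∀ l i l' i' → x l i ≡ x l' i' → (l ≡ l') × (i ≡ i')) ×
  (∀ l i → toℕ i < j → x l i ∈ A₁) ×
  (∀ l i → j ≤ toℕ i → x l i ∈ A₂) ×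
  (∀ l l' → rowSum (x l) ≡ rowSum (x l'))

SameSet : ∀ {k h d} → Config k h d → Config k h d → Set
SameSet {d = d} x y =
  (p : Point d) → (∃ λ l → ∃ λ i → x l i ≡ p) ⇔ (∃ λ l → ∃ λ i → y l i ≡ p)

-- f_{d,k,h,j}(A₁,A₂) ≥ m : there are m admissible families with pairwise
-- distinct underlying kh-element sets.
fAtLeast : ∀ {d} k h → ℕ → List (Point d) → List (Point d) → ℕ → Set
fAtLeast {d} k h j A₁ A₂ m =
  Σ (Fin m → Config k h d) λ X →
    (∀ a → Admissible k h j A₁ A₂ (X a)) ×
    (∀ a b → SameSet (X a) (X b) → a ≡ b)

-- s ≥ n^{(k-1)d/k} · log₂ n, expressed without reals:
-- for every rational p/q < log₂ n (i.e. 2^p < n^q) we have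
-- (p/q)^k ≤ s^k / n^{(k-1)d}.
LogBound : ℕ → ℕ → ℕ → ℕ → Set
LogBound d k n s =
  (p q : ℕ) → 1 ≤ q → 2 ^ p < n ^ q →
  p ^ k * n ^ ((k ∸ 1) * d) ≤ q ^ k * s ^ k

Disjoint : ∀ {d} → List (Point d) → List (Point d) → Set
Disjoint {d} A₁ A₂ = (p : Point d) → p ∈ A₁ → p ∉ A₂

module Submission where

-- Split A₁ into j blocks and A₂ into h − j blocks of sizes w₁ ≈ |A₁|/j and w₂ ≈ |A₂|/(h − j), and
-- call a choice of one point from each block a row: there are R = w₁^j w₂^(h−j) rows, and their
-- sums take at most N = (hn + 1)^d values σ.  A row with sum σ is determined by all but one of
-- its entries, so at most M ≈ R/w² rows with sum σ share a prescribed entry.  Once w² ≫ khN,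
-- extending chains greedily gives at least (c_σ − khM)^k sequences of k rows with sum σ and
-- pairwise distinct entries, where c_σ is the number of rows with sum σ.  Summing over σ gives
-- ≳ R^k/N^(k−1) admissible families, and each kh-element set comes from at most (k^h)^k of them.
-- The hypothesis |A| ≥ n^((k−1)d/k) log n is used only at a rational below log₂ n, to make the
-- blocks large enough.

open import Defs
open import Data.Nat
open import Data.Nat.Properties
open import Data.Nat.DivMod using (m≡m%n+[m/n]*n; m%n≤n; m*n/n≡m; /-monoˡ-≤; m≥n⇒m/n>0; m/n*n≤m)
open import Data.Nat.ListAction using (sum)
open import Data.Nat.Tactic.RingSolver using (solve-∀)
open import Algebra.Properties.CommutativeSemigroup +-commutativeSemigroup using () renaming (interchange to +-interchange)
open import Algebra.Properties.CommutativeSemigroup *-commutativeSemigroup using (xy∙z≈zy∙x) renaming (interchange to *-interchange)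
open import Data.Fin using (Fin; toℕ) renaming (zero to fzero; suc to fsuc)
import Data.Fin.Properties as Fin
open import Data.Fin.Properties using (all?; any?; ¬∀⟶∃¬)
open import Data.Vec using (Vec; []; _∷_; lookup; replicate; tabulate; zipWith; _[_]≔_) renaming (_++_ to _++ᵥ_)
open import Data.Vec.Properties using (≡-dec; ∷-injective; ∷-injectiveˡ; ∷-injectiveʳ; lookup∘update; lookup∘update′; []≔-lookup; []≔-idempotent; lookup-replicate; lookup-zipWith; lookup∘tabulate; zipWith-identityˡ)
open import Data.Vec.Relation.Unary.All.Properties using (lookup⁺)
open import Data.List as List using (List; []; _∷_; [_]; length; map; filter; concatMap; take; drop; upTo; deduplicate)
open import Data.List.Properties using (length-++; length-map; map-cong; filter-notAll; length-take; length-drop; length-upTo; length-tabulate)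
open import Data.List.Membership.Propositional using (_∈_; find)
open import Data.List.Membership.Propositional.Properties using (∈-filter⁺; ∈-filter⁻; ∈-map⁺; ∈-map⁻; ∈-concatMap⁺; ∈-concatMap⁻; ∈-upTo⁺; ∈-tabulate⁺; ∈-lookup; ∈-deduplicate⁻)
open import Data.List.Relation.Unary.Any as Any using (Any; here; there)
open import Data.List.Relation.Unary.Any.Properties using (deduplicate⁺)
open import Data.List.Relation.Unary.All as All using (All; []; _∷_)
open import Data.List.Relation.Unary.All.Properties using (map⁺)
open import Data.List.Relation.Unary.AllPairs using (AllPairs)
open import Data.List.Relation.Unary.Unique.Propositional using (Unique; []; _∷_)
import Data.List.Relation.Unary.Unique.Propositional.Properties as Unique
open import Data.List.Relation.Unary.Unique.DecSetoid.Properties using (deduplicate-!)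
open import Data.Product using (Σ; ∃; _×_; _,_; proj₁; proj₂)
open import Data.Sum using (_⊎_; inj₁; inj₂)
open import Function using (_∘_; _on_)
open import Function.Bundles using (Equivalence)
open import Level using (0ℓ)
open import Relation.Nullary using (¬_; yes; no; ¬?; contradiction)
open import Relation.Nullary.Decidable using (decidable-stable; _×-dec_)
open import Relation.Unary using (Pred; Decidable)
open import Relation.Unary.Properties using (∁?; _∪?_)
open import Relation.Binary.Core using (Rel)
import Relation.Binary.Definitions as B
open import Relation.Binary.Definitions using (DecidableEquality; Symmetric)
open import Relation.Binary.Bundles using (DecSetoid)
open import Relation.Binary.PropositionalEquality using (_≡_; _≢_; refl; sym; trans; cong; cong₂; subst; subst₂; module ≡-Reasoning)

^-distribʳ-* : ∀ m n o → (m * n) ^ o ≡ m ^ o * n ^ o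
^-distribʳ-* m n zero    = refl
^-distribʳ-* m n (suc o) = begin-equality
  m * n * (m * n) ^ o      ≡⟨ cong (m * n *_) (^-distribʳ-* m n o) ⟩
  m * n * (m ^ o * n ^ o)  ≡⟨ *-interchange m n (m ^ o) (n ^ o) ⟩
  m * m ^ o * (n * n ^ o)  ∎
  where open ≤-Reasoning

^-cancelˡ-≤ : ∀ n .{{_ : NonZero n}} {m o} → m ^ n ≤ o ^ n → m ≤ o
^-cancelˡ-≤ n {m} {o} mⁿ≤oⁿ with m ≤? o
... | yes m≤o = m≤o
... | no m≰o  = contradiction mⁿ≤oⁿ (<⇒≱ (^-monoˡ-< n (≰⇒> m≰o)))

m*n≤o⇒m≤o/n : ∀ m n o .{{_ : NonZero n}} → m * n ≤ o → m ≤ o / n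
m*n≤o⇒m≤o/n m n o mn≤o = begin
  m          ≡⟨ m*n/n≡m m n ⟨
  m * n / n  ≤⟨ /-monoˡ-≤ n mn≤o ⟩
  o / n      ∎
  where open ≤-Reasoning

m≤2*n*[m/n] : ∀ m n .{{_ : NonZero n}} → n ≤ m → m ≤ 2 * n * (m / n)
m≤2*n*[m/n] m n n≤m = begin
  m                            ≡⟨ m≡m%n+[m/n]*n m n ⟩
  m % n + m / n * n            ≤⟨ +-monoˡ-≤ (m / n * n) (m%n≤n m n) ⟩
  n + m / n * n                ≤⟨ +-monoˡ-≤ (m / n * n) n≤[m/n]*n ⟩
  m / n * n + m / n * n        ≡⟨ double (m / n) n ⟩
  2 * n * (m / n)              ∎
  where
  open ≤-Reasoning
  n≤[m/n]*n : n ≤ m / n * n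
  n≤[m/n]*n = subst (_≤ m / n * n) (*-identityˡ n) (*-monoˡ-≤ n (m≥n⇒m/n>0 n≤m))
  double : ∀ q n → q * n + q * n ≡ 2 * n * q
  double = solve-∀

m≤2*[m∸n] : ∀ m n → 2 * n ≤ m → m ≤ 2 * (m ∸ n)
m≤2*[m∸n] m n 2n≤m = begin
  m                  ≡⟨ m∸n+n≡m n≤m ⟨
  m ∸ n + n          ≤⟨ +-monoʳ-≤ (m ∸ n) n≤m∸n ⟩
  m ∸ n + (m ∸ n)    ≡⟨ cong (m ∸ n +_) (+-identityʳ (m ∸ n)) ⟨
  2 * (m ∸ n)        ∎
  where
  open ≤-Reasoning
  n+n≤m : n + n ≤ m
  n+n≤m = subst (_≤ m) (cong (n +_) (+-identityʳ n)) 2n≤m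
  n≤m : n ≤ m
  n≤m = ≤-trans (m≤m+n n n) n+n≤m
  n≤m∸n : n ≤ m ∸ n
  n≤m∸n = subst (_≤ m ∸ n) (m+n∸n≡m n n) (∸-monoˡ-≤ n n+n≤m)

-- stands in for the convexity of x ↦ x^(1+k) when the chains are summed over the row totals
t^k*[x∸t]≤x^[1+k] : ∀ x t k → t ^ k * (x ∸ t) ≤ x ^ suc k
t^k*[x∸t]≤x^[1+k] x t k with x ≤? t
... | yes x≤t = begin
  t ^ k * (x ∸ t)  ≡⟨ cong (t ^ k *_) (m≤n⇒m∸n≡0 x≤t) ⟩
  t ^ k * 0        ≡⟨ *-zeroʳ (t ^ k) ⟩
  0                ≤⟨ z≤n ⟩
  x ^ suc k        ∎
  where open ≤-Reasoning
... | no x≰t = begin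
  t ^ k * (x ∸ t)  ≤⟨ *-mono-≤ (^-monoˡ-≤ k (<⇒≤ (≰⇒> x≰t))) (m∸n≤m x t) ⟩
  x ^ k * x        ≡⟨ *-comm (x ^ k) x ⟩
  x ^ suc k        ∎
  where open ≤-Reasoning

-- Counting in lists

module _ {A : Set} where

  count : {P : Pred A 0ℓ} → Decidable P → List A → ℕ
  count P? xs = length (filter P? xs)

  module _ {P : Pred A 0ℓ} (P? : Decidable P) where

    count+count-∁≡length : ∀ xs → count P? xs + count (∁? P?) xs ≡ length xs
    count+count-∁≡length []       = refl
    count+count-∁≡length (x ∷ xs) with P? x
    ... | yes _ = cong suc (count+count-∁≡length xs)
    ... | no _  = trans (+-suc (count P? xs) _) (cong suc (count+count-∁≡length xs))

    length∸≤count : ∀ xs {M} → count (∁? P?) xs ≤ M → length xs ∸ M ≤ count P? xs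
    length∸≤count xs {M} bad≤M = m≤n+o⇒m∸n≤o (length xs) M (begin
      length xs                           ≡⟨ count+count-∁≡length xs ⟨
      count P? xs + count (∁? P?) xs      ≤⟨ +-monoʳ-≤ (count P? xs) bad≤M ⟩
      count P? xs + M                     ≡⟨ +-comm (count P? xs) M ⟩
      M + count P? xs                     ∎)
      where open ≤-Reasoning

    module _ {Q : Pred A 0ℓ} (Q? : Decidable Q) where

      count-mono : ∀ xs → (∀ {x} → x ∈ xs → P x → Q x) → count P? xs ≤ count Q? xs
      count-mono []       P⇒Q = z≤n
      count-mono (x ∷ xs) P⇒Q with P? x | Q? x
      ... | yes _  | yes _  = s≤s (count-mono xs (P⇒Q ∘ there))
      ... | yes px | no ¬qx = contradiction (P⇒Q (here refl) px) ¬qx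
      ... | no _   | yes _  = m≤n⇒m≤1+n (count-mono xs (P⇒Q ∘ there))
      ... | no _   | no _   = count-mono xs (P⇒Q ∘ there)

      count-∪ : ∀ xs → count (P? ∪? Q?) xs ≤ count P? xs + count Q? xs
      count-∪ []       = z≤n
      count-∪ (x ∷ xs) with P? x | Q? x
      ... | yes _ | yes _ = s≤s (≤-trans (count-∪ xs) (+-monoʳ-≤ (count P? xs) (n≤1+n _)))
      ... | yes _ | no _  = s≤s (count-∪ xs)
      ... | no _  | yes _ = subst (suc (count (P? ∪? Q?) xs) ≤_) (sym (+-suc _ _)) (s≤s (count-∪ xs))
      ... | no _  | no _  = count-∪ xs

  count-∃ : ∀ n {P : Fin n → Pred A 0ℓ} (P? : ∀ i → Decidable (P i)) xs {M} →
            (∀ i → count (P? i) xs ≤ M) → count (λ x → any? (λ i → P? i x)) xs ≤ n * M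
  count-∃ zero    P? xs bound = ≤-reflexive (none xs)
    where
    none : ∀ xs → count (λ x → any? {zero} (λ i → P? i x)) xs ≡ 0
    none []       = refl
    none (_ ∷ xs) = none xs
  count-∃ (suc n) {P} P? xs {M} bound = begin
    count (λ x → any? (λ i → P? i x)) xs
      ≤⟨ count-mono _ (P? fzero ∪? (λ x → any? (λ i → P? (fsuc i) x))) xs split ⟩
    count (P? fzero ∪? (λ x → any? (λ i → P? (fsuc i) x))) xs
      ≤⟨ count-∪ (P? fzero) _ xs ⟩
    count (P? fzero) xs + count (λ x → any? (λ i → P? (fsuc i) x)) xs
      ≤⟨ +-mono-≤ (bound fzero) (count-∃ n (λ i → P? (fsuc i)) xs (λ i → bound (fsuc i))) ⟩
    M + n * M ∎
    where
    open ≤-Reasoning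
    split : ∀ {x} → x ∈ xs → ∃ (λ i → P i x) → P fzero x ⊎ ∃ (λ i → P (fsuc i) x)
    split _ (fzero  , p) = inj₁ p
    split _ (fsuc i , p) = inj₂ (i , p)

module _ {B : Set} where

  sum-map-+ : ∀ (f g : B → ℕ) ys → sum (map (λ y → f y + g y) ys) ≡ sum (map f ys) + sum (map g ys)
  sum-map-+ f g []       = refl
  sum-map-+ f g (y ∷ ys) = begin-equality
    f y + g y + sum (map (λ y → f y + g y) ys)     ≡⟨ cong (f y + g y +_) (sum-map-+ f g ys) ⟩
    f y + g y + (sum (map f ys) + sum (map g ys))  ≡⟨ +-interchange (f y) (g y) _ _ ⟩
    f y + sum (map f ys) + (g y + sum (map g ys))  ∎
    where open ≤-Reasoning

  sum-map-*ˡ : ∀ c (f : B → ℕ) ys → sum (map (λ y → c * f y) ys) ≡ c * sum (map f ys)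
  sum-map-*ˡ c f []       = sym (*-zeroʳ c)
  sum-map-*ˡ c f (y ∷ ys) = trans (cong (c * f y +_) (sum-map-*ˡ c f ys)) (sym (*-distribˡ-+ c (f y) _))

  sum-map-const : ∀ c (ys : List B) → sum (map (λ _ → c) ys) ≡ length ys * c
  sum-map-const c []       = refl
  sum-map-const c (y ∷ ys) = cong (c +_) (sum-map-const c ys)

  sum-map-mono : ∀ {f g : B → ℕ} ys → (∀ {y} → y ∈ ys → f y ≤ g y) → sum (map f ys) ≤ sum (map g ys)
  sum-map-mono []       f≤g = z≤n
  sum-map-mono (y ∷ ys) f≤g = +-mono-≤ (f≤g (here refl)) (sum-map-mono ys (f≤g ∘ there))

  sum-map-∸ : ∀ (f : B → ℕ) c ys → sum (map f ys) ∸ length ys * c ≤ sum (map (λ y → f y ∸ c) ys)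
  sum-map-∸ f c []       = z≤n
  sum-map-∸ f c (y ∷ ys) = begin
    (f y + sum (map f ys)) ∸ (c + length ys * c)    ≤⟨ ∸-+-≤ (f y) _ c _ ⟩
    (f y ∸ c) + (sum (map f ys) ∸ length ys * c)    ≤⟨ +-monoʳ-≤ (f y ∸ c) (sum-map-∸ f c ys) ⟩
    (f y ∸ c) + sum (map (λ y → f y ∸ c) ys)        ∎
    where
    open ≤-Reasoning
    ∸-+-≤ : ∀ a b c d → (a + b) ∸ (c + d) ≤ (a ∸ c) + (b ∸ d)
    ∸-+-≤ a b c d = m≤n+o⇒m∸n≤o (a + b) (c + d) (begin
      a + b                          ≤⟨ +-mono-≤ (m≤n+m∸n a c) (m≤n+m∸n b d) ⟩
      (c + (a ∸ c)) + (d + (b ∸ d))  ≡⟨ +-interchange c (a ∸ c) d (b ∸ d) ⟩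
      (c + d) + ((a ∸ c) + (b ∸ d))  ∎)

  ∈⇒≤sum-map : ∀ (f : B → ℕ) {y ys} → y ∈ ys → f y ≤ sum (map f ys)
  ∈⇒≤sum-map f {ys = z ∷ ys} (here refl) = m≤m+n (f z) _
  ∈⇒≤sum-map f {ys = z ∷ ys} (there y∈ys) = ≤-trans (∈⇒≤sum-map f y∈ys) (m≤n+m _ (f z))

  length-concatMap : ∀ {A : Set} (f : B → List A) ys → length (concatMap f ys) ≡ sum (map (length ∘ f) ys)
  length-concatMap f []       = refl
  length-concatMap f (y ∷ ys) = trans (length-++ (f y)) (cong (length (f y) +_) (length-concatMap f ys))

module _ {A B : Set} {P : B → Pred A 0ℓ} (P? : ∀ y → Decidable (P y)) (Y : List B) where

  length≤sum-count : ∀ xs → (∀ {x} → x ∈ xs → ∃ λ y → y ∈ Y × P y x) →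
                     length xs ≤ sum (map (λ y → count (P? y) xs) Y)
  length≤sum-count []       covered = z≤n
  length≤sum-count (x ∷ xs) covered with covered (here refl)
  ... | y , y∈Y , pyx = begin
    suc (length xs)
      ≤⟨ +-mono-≤ (≤-trans (≤-reflexive (sym (count-singleton y pyx))) (∈⇒≤sum-map (λ y → count (P? y) (x ∷ [])) y∈Y))
                  (length≤sum-count xs (covered ∘ there)) ⟩
    sum (map (λ y → count (P? y) (x ∷ [])) Y) + sum (map (λ y → count (P? y) xs) Y)
      ≡⟨ sum-map-+ (λ y → count (P? y) (x ∷ [])) (λ y → count (P? y) xs) Y ⟨
    sum (map (λ y → count (P? y) (x ∷ []) + count (P? y) xs) Y)
      ≡⟨ cong sum (map-cong count-∷ Y) ⟩
    sum (map (λ y → count (P? y) (x ∷ xs)) Y) ∎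
    where
    open ≤-Reasoning
    count-singleton : ∀ y → P y x → count (P? y) (x ∷ []) ≡ 1
    count-singleton y pyx with P? y x
    ... | yes _   = refl
    ... | no ¬pyx = contradiction pyx ¬pyx
    count-∷ : ∀ y → count (P? y) (x ∷ []) + count (P? y) xs ≡ count (P? y) (x ∷ xs)
    count-∷ y with P? y x
    ... | yes _ = refl
    ... | no _  = refl

module _ {A : Set} where

  unique-⊆⇒length≤ : DecidableEquality A → ∀ {xs ys : List A} → Unique xs → (∀ {x} → x ∈ xs → x ∈ ys) →
                     length xs ≤ length ys
  unique-⊆⇒length≤ _≟_ {[]}     _            _     = z≤n
  unique-⊆⇒length≤ _≟_ {x ∷ xs} {ys} (x∉xs ∷ !xs) xs⊆ys = begin-strict
    length xs      ≤⟨ unique-⊆⇒length≤ _≟_ !xs xs⊆others ⟩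
    length others  <⟨ filter-notAll (¬? ∘ (x ≟_)) ys (Any.map (λ x≡y x≢y → x≢y x≡y) (xs⊆ys (here refl))) ⟩
    length ys      ∎
    where
    open ≤-Reasoning
    others = filter (¬? ∘ (x ≟_)) ys
    xs⊆others : ∀ {y} → y ∈ xs → y ∈ others
    xs⊆others y∈xs = ∈-filter⁺ (¬? ∘ (x ≟_)) (xs⊆ys (there y∈xs)) (All.lookup x∉xs y∈xs)

module _ {A B : Set} where

  unique-map⁺ : ∀ {f : A → B} {xs} → (∀ {x y} → x ∈ xs → y ∈ xs → f x ≡ f y → x ≡ y) →
                Unique xs → Unique (map f xs)
  unique-map⁺ {xs = []}     inj []          = []
  unique-map⁺ {xs = x ∷ xs} inj (x∉xs ∷ !xs) =
    map⁺ (All.tabulate (λ {y} y∈xs fx≡fy → All.lookup x∉xs y∈xs (inj (here refl) (there y∈xs) fx≡fy)))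
    ∷ unique-map⁺ (λ x∈ y∈ → inj (there x∈) (there y∈)) !xs

  unique-concatMap⁺ : ∀ {f : A → List B} {xs} → Unique xs → (∀ {x} → x ∈ xs → Unique (f x)) →
                      (∀ {x x′ y} → x ∈ xs → x′ ∈ xs → y ∈ f x → y ∈ f x′ → x ≡ x′) →
                      Unique (concatMap f xs)
  unique-concatMap⁺ {xs = []}     []           _  _       = []
  unique-concatMap⁺ {f} {xs = x ∷ xs} (x∉xs ∷ !xs) !f shared =
    Unique.++⁺ (!f (here refl)) (unique-concatMap⁺ !xs (!f ∘ there) (λ x∈ x′∈ → shared (there x∈) (there x′∈))) disjoint
    where
    disjoint : ∀ {y} → ¬ (y ∈ f x × y ∈ concatMap f xs)
    disjoint (y∈fx , y∈rest) with find (∈-concatMap⁻ f y∈rest)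
    ... | x′ , x′∈xs , y∈fx′ = All.lookup x∉xs x′∈xs (shared (here refl) (there x′∈xs) y∈fx y∈fx′)

-- Products of lists

module _ {A : Set} where

  choices : ∀ {n} → Vec (List A) n → List (Vec A n)
  choices []       = [ [] ]
  choices (L ∷ Ls) = concatMap (λ x → map (x ∷_) (choices Ls)) L

  ∏length : ∀ {n} → Vec (List A) n → ℕ
  ∏length []       = 1
  ∏length (L ∷ Ls) = length L * ∏length Ls

  length-choices : ∀ {n} (Ls : Vec (List A) n) → length (choices Ls) ≡ ∏length Ls
  length-choices []       = refl
  length-choices (L ∷ Ls) = begin-equality
    length (concatMap (λ x → map (x ∷_) (choices Ls)) L)    ≡⟨ length-concatMap _ L ⟩
    sum (map (λ x → length (map (x ∷_) (choices Ls))) L)    ≡⟨ cong sum (map-cong (λ x → length-map (x ∷_) (choices Ls)) L) ⟩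
    sum (map (λ _ → length (choices Ls)) L)                 ≡⟨ sum-map-const _ L ⟩
    length L * length (choices Ls)                          ≡⟨ cong (length L *_) (length-choices Ls) ⟩
    length L * ∏length Ls                                   ∎
    where open ≤-Reasoning

  ∈-choices⁺ : ∀ {n} (Ls : Vec (List A) n) {v} → (∀ i → lookup v i ∈ lookup Ls i) → v ∈ choices Ls
  ∈-choices⁺ []       {[]}    _   = here refl
  ∈-choices⁺ (L ∷ Ls) {x ∷ v} v∈Ls =
    ∈-concatMap⁺ (λ y → map (y ∷_) (choices Ls))
      (Any.map (λ { refl → ∈-map⁺ (x ∷_) (∈-choices⁺ Ls (v∈Ls ∘ fsuc)) }) (v∈Ls fzero))

  ∈-choices⁻ : ∀ {n} (Ls : Vec (List A) n) {v} → v ∈ choices Ls → ∀ i → lookup v i ∈ lookup Ls i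
  ∈-choices⁻ (L ∷ Ls) {x ∷ v} v∈ i with find (∈-concatMap⁻ (λ y → map (y ∷_) (choices Ls)) {xs = L} v∈)
  ... | y , y∈L , x∷v∈ with ∈-map⁻ (y ∷_) x∷v∈
  ...   | w , w∈ , refl with i
  ...     | fzero  = y∈L
  ...     | fsuc i = ∈-choices⁻ Ls w∈ i

  choices-unique : ∀ {n} (Ls : Vec (List A) n) → (∀ i → Unique (lookup Ls i)) → Unique (choices Ls)
  choices-unique []       _   = [] ∷ []
  choices-unique (L ∷ Ls) !Ls = unique-concatMap⁺ (!Ls fzero)
    (λ _ → Unique.map⁺ ∷-injectiveʳ (choices-unique Ls (!Ls ∘ fsuc)))
    (λ _ _ y∈ y∈′ → heads y∈ y∈′)
    where
    heads : ∀ {x x′ y} → y ∈ map (x ∷_) (choices Ls) → y ∈ map (x′ ∷_) (choices Ls) → x ≡ x′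
    heads {x} {x′} y∈ y∈′ with ∈-map⁻ (x ∷_) y∈ | ∈-map⁻ (x′ ∷_) y∈′
    ... | _ , _ , refl | _ , _ , eq = ∷-injectiveˡ eq

  ∏length-uniform : ∀ {c} (Q : Vec (List A) c) w → (∀ i → length (lookup Q i) ≡ w) → ∏length Q ≡ w ^ c
  ∏length-uniform []      w _       = refl
  ∏length-uniform (L ∷ Q) w lengths = cong₂ _*_ (lengths fzero) (∏length-uniform Q w (lengths ∘ fsuc))

  ∏length-++ : ∀ {a b} (Q₁ : Vec (List A) a) (Q₂ : Vec (List A) b) → ∏length (Q₁ ++ᵥ Q₂) ≡ ∏length Q₁ * ∏length Q₂
  ∏length-++ []       Q₂ = sym (+-identityʳ _)
  ∏length-++ (L ∷ Q₁) Q₂ = trans (cong (length L *_) (∏length-++ Q₁ Q₂)) (sym (*-assoc (length L) _ _))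

  ∏length-[]≔ : ∀ {n} (Ls : Vec (List A) n) i L → ∏length (Ls [ i ]≔ L) * length (lookup Ls i) ≡ ∏length Ls * length L
  ∏length-[]≔ (L₀ ∷ Ls) fzero    L = xy∙z≈zy∙x (length L) (∏length Ls) (length L₀)
  ∏length-[]≔ (L₀ ∷ Ls) (fsuc i) L = begin
    length L₀ * ∏length (Ls [ i ]≔ L) * length (lookup Ls i)   ≡⟨ *-assoc (length L₀) _ _ ⟩
    length L₀ * (∏length (Ls [ i ]≔ L) * length (lookup Ls i)) ≡⟨ cong (length L₀ *_) (∏length-[]≔ Ls i L) ⟩
    length L₀ * (∏length Ls * length L)                         ≡⟨ *-assoc (length L₀) _ _ ⟨
    length L₀ * ∏length Ls * length L                           ∎
    where open ≡-Reasoning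

  ∏length-[]≔-singleton : ∀ {n} (Ls : Vec (List A) n) i {x} → ∏length (Ls [ i ]≔ [ x ]) * length (lookup Ls i) ≡ ∏length Ls
  ∏length-[]≔-singleton Ls i {x} = trans (∏length-[]≔ Ls i [ x ]) (*-identityʳ (∏length Ls))

  ^≤∏length : ∀ {μ m} (Q : Vec (List A) m) → (∀ i → μ ≤ length (lookup Q i)) → μ ^ m ≤ ∏length Q
  ^≤∏length []      _   = ≤-refl
  ^≤∏length (L ∷ Q) μ≤Q = *-mono-≤ (μ≤Q fzero) (^≤∏length Q (μ≤Q ∘ fsuc))

-- Splitting a list into blocks

module _ {X : Set} where

  PairwiseDisjoint : ∀ {n} → Vec (List X) n → Set
  PairwiseDisjoint Q = ∀ i i′ {x} → x ∈ lookup Q i → x ∈ lookup Q i′ → i ≡ i′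

  chunks : (c w : ℕ) → List X → Vec (List X) c
  chunks zero    w L = []
  chunks (suc c) w L = take w L ∷ chunks c w (drop w L)

  private
    ∈-take : ∀ w {L : List X} {x} → x ∈ take w L → x ∈ L
    ∈-take (suc w) {y ∷ L} (here refl) = here refl
    ∈-take (suc w) {y ∷ L} (there x∈) = there (∈-take w x∈)

    ∈-drop : ∀ w {L : List X} {x} → x ∈ drop w L → x ∈ L
    ∈-drop zero    x∈ = x∈
    ∈-drop (suc w) {y ∷ L} x∈ = there (∈-drop w x∈)

    take-drop-disjoint : ∀ w {L : List X} {x} → Unique L → x ∈ take w L → ¬ x ∈ drop w L
    take-drop-disjoint (suc w) {y ∷ L} (y∉L ∷ _)  (here refl) x∈ = All.lookup y∉L (∈-drop w x∈) refl
    take-drop-disjoint (suc w) {y ∷ L} (_ ∷ !L) (there x∈) = take-drop-disjoint w !L x∈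

  chunks-⊆ : ∀ c w {L : List X} i {x} → x ∈ lookup (chunks c w L) i → x ∈ L
  chunks-⊆ (suc c) w fzero    x∈ = ∈-take w x∈
  chunks-⊆ (suc c) w (fsuc i) x∈ = ∈-drop w (chunks-⊆ c w i x∈)

  chunks-unique : ∀ c w {L : List X} → Unique L → ∀ i → Unique (lookup (chunks c w L) i)
  chunks-unique (suc c) w !L fzero    = Unique.take⁺ w !L
  chunks-unique (suc c) w !L (fsuc i) = chunks-unique c w (Unique.drop⁺ w !L) i

  chunks-disjoint : ∀ c w {L : List X} → Unique L → PairwiseDisjoint (chunks c w L)
  chunks-disjoint (suc c) w !L fzero    fzero     x∈ x∈′ = refl
  chunks-disjoint (suc c) w !L fzero    (fsuc i′) x∈ x∈′ = contradiction (chunks-⊆ c w i′ x∈′) (take-drop-disjoint w !L x∈)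
  chunks-disjoint (suc c) w !L (fsuc i) fzero     x∈ x∈′ = contradiction (chunks-⊆ c w i x∈) (take-drop-disjoint w !L x∈′)
  chunks-disjoint (suc c) w !L (fsuc i) (fsuc i′) x∈ x∈′ = cong fsuc (chunks-disjoint c w (Unique.drop⁺ w !L) i i′ x∈ x∈′)

  length-chunks : ∀ c w {L : List X} → c * w ≤ length L → ∀ i → length (lookup (chunks c w L) i) ≡ w
  length-chunks (suc c) w {L} cw≤ fzero    = trans (length-take w L) (m≤n⇒m⊓n≡m (≤-trans (m≤m+n w (c * w)) cw≤))
  length-chunks (suc c) w {L} cw≤ (fsuc i) = length-chunks c w cw≤′ i
    where
    cw≤′ : c * w ≤ length (drop w L)
    cw≤′ = subst (c * w ≤_) (sym (length-drop w L)) (subst (_≤ length L ∸ w) (m+n∸m≡n w (c * w)) (∸-monoˡ-≤ w cw≤))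

module _ {Y : Set} where

  lookup-++-cases : ∀ {a b} (Q₁ : Vec Y a) (Q₂ : Vec Y b) (i : Fin (a + b)) →
    (toℕ i < a × Σ (Fin a) λ p → lookup (Q₁ ++ᵥ Q₂) i ≡ lookup Q₁ p) ⊎
    (a ≤ toℕ i × Σ (Fin b) λ q → lookup (Q₁ ++ᵥ Q₂) i ≡ lookup Q₂ q)
  lookup-++-cases []       Q₂ i        = inj₂ (z≤n , i , refl)
  lookup-++-cases (y ∷ Q₁) Q₂ fzero    = inj₁ (s≤s z≤n , fzero , refl)
  lookup-++-cases (y ∷ Q₁) Q₂ (fsuc i) with lookup-++-cases Q₁ Q₂ i
  ... | inj₁ (i<a , p , eq) = inj₁ (s≤s i<a , fsuc p , eq)
  ... | inj₂ (a≤i , q , eq) = inj₂ (s≤s a≤i , q , eq)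

module _ {X : Set} where

  ++-pairwiseDisjoint : ∀ {a b} (Q₁ : Vec (List X) a) (Q₂ : Vec (List X) b) →
    PairwiseDisjoint Q₁ → PairwiseDisjoint Q₂ → (∀ p q {x} → x ∈ lookup Q₁ p → ¬ x ∈ lookup Q₂ q) →
    PairwiseDisjoint (Q₁ ++ᵥ Q₂)
  ++-pairwiseDisjoint []       Q₂ _  disj₂ _      i i′ = disj₂ i i′
  ++-pairwiseDisjoint (L ∷ Q₁) Q₂ disj₁ disj₂ cross = go
    where
    go : PairwiseDisjoint ((L ∷ Q₁) ++ᵥ Q₂)
    go fzero    fzero     _  _   = refl
    go fzero    (fsuc i′) x∈ x∈′ with lookup-++-cases Q₁ Q₂ i′
    ... | inj₁ (_ , p , eq) = contradiction (disj₁ fzero (fsuc p) x∈ (subst (_ ∈_) eq x∈′)) λ ()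
    ... | inj₂ (_ , q , eq) = contradiction (subst (_ ∈_) eq x∈′) (cross fzero q x∈)
    go (fsuc i) fzero     x∈ x∈′ with lookup-++-cases Q₁ Q₂ i
    ... | inj₁ (_ , p , eq) = contradiction (disj₁ fzero (fsuc p) x∈′ (subst (_ ∈_) eq x∈)) λ ()
    ... | inj₂ (_ , q , eq) = contradiction (subst (_ ∈_) eq x∈) (cross fzero q x∈′)
    go (fsuc i) (fsuc i′) x∈ x∈′ =
      cong fsuc (++-pairwiseDisjoint Q₁ Q₂ (λ p p′ y∈ y∈′ → Fin.suc-injective (disj₁ (fsuc p) (fsuc p′) y∈ y∈′)) disj₂
                  (cross ∘ fsuc) i i′ x∈ x∈′)

-- Row totals and their fibres

_≟ₚ_ : ∀ {d} → DecidableEquality (Point d)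
_≟ₚ_ = ≡-dec _≟_

_+ₚ_ : ∀ {d} → Point d → Point d → Point d
_+ₚ_ = zipWith _+_

0ₚ : ∀ {d} → Point d
0ₚ = replicate _ 0

+ₚ-cancelʳ : ∀ {d} (x y z : Point d) → x +ₚ z ≡ y +ₚ z → x ≡ y
+ₚ-cancelʳ []      []      []      _  = refl
+ₚ-cancelʳ (a ∷ x) (b ∷ y) (c ∷ z) eq with ∷-injective eq
... | a+c≡b+c , eq′ = cong₂ _∷_ (+-cancelʳ-≡ c a b a+c≡b+c) (+ₚ-cancelʳ x y z eq′)

+ₚ-swap : ∀ {d} (x y z : Point d) → x +ₚ (y +ₚ z) ≡ y +ₚ (x +ₚ z)
+ₚ-swap []      []      []      = refl
+ₚ-swap (a ∷ x) (b ∷ y) (c ∷ z) = cong₂ _∷_ (x+[y+z]≡y+[x+z] a b c) (+ₚ-swap x y z)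
  where
  x+[y+z]≡y+[x+z] : ∀ a b c → a + (b + c) ≡ b + (a + c)
  x+[y+z]≡y+[x+z] a b c = trans (sym (+-assoc a b c)) (trans (cong (_+ c) (+-comm a b)) (+-assoc b a c))

total : ∀ {d h} → Vec (Point d) h → Point d
total ρ = rowSum (lookup ρ)

total-split : ∀ {d h} (ρ : Vec (Point d) h) a → total ρ ≡ lookup ρ a +ₚ total (ρ [ a ]≔ 0ₚ)
total-split (x ∷ ρ) fzero    = cong (x +ₚ_) (sym (zipWith-identityˡ +-identityˡ (total ρ)))
total-split (x ∷ ρ) (fsuc a) = trans (cong (x +ₚ_) (total-split ρ a)) (+ₚ-swap x (lookup ρ a) _)

module _ {A : Set} where

  []≔-injective : ∀ {n} {xs ys : Vec A n} i {y} → xs [ i ]≔ y ≡ ys [ i ]≔ y → lookup xs i ≡ lookup ys i → xs ≡ ys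
  []≔-injective {xs = xs} {ys} i {y} eq eqᵢ = begin
    xs                                 ≡⟨ []≔-lookup xs i ⟨
    xs [ i ]≔ lookup xs i              ≡⟨ []≔-idempotent xs i ⟨
    (xs [ i ]≔ y) [ i ]≔ lookup xs i   ≡⟨ cong₂ (λ zs z → zs [ i ]≔ z) eq eqᵢ ⟩
    (ys [ i ]≔ y) [ i ]≔ lookup ys i   ≡⟨ []≔-idempotent ys i ⟩
    ys [ i ]≔ lookup ys i              ≡⟨ []≔-lookup ys i ⟩
    ys                                 ∎
    where open ≡-Reasoning

  []≔-∈ : ∀ {n} (xs : Vec A n) (Ls : Vec (List A) n) i {x L} →
          (∀ a → lookup xs a ∈ lookup Ls a) → x ∈ L → ∀ a → lookup (xs [ i ]≔ x) a ∈ lookup (Ls [ i ]≔ L) a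
  []≔-∈ xs Ls i {x} {L} xs∈Ls x∈L a with a Fin.≟ i
  ... | yes refl = subst₂ _∈_ (sym (lookup∘update i xs x)) (sym (lookup∘update i Ls L)) x∈L
  ... | no a≢i   = subst₂ _∈_ (sym (lookup∘update′ a≢i xs x)) (sym (lookup∘update′ a≢i Ls L)) (xs∈Ls a)

module _ {d h} (Q : Vec (List (Point d)) h) {i i′ : Fin h} (i′≢i : i′ ≢ i) (σ v : Point d) where

  private
    𝟎 : Point d
    𝟎 = 0ₚ

    withTotal : List (Vec (Point d) h)
    withTotal = filter (λ ρ → total ρ ≟ₚ σ) (choices Q)

    fibre : List (Vec (Point d) h)
    fibre = filter (λ ρ → lookup ρ i ≟ₚ v) withTotal

    i≢i′ : i ≢ i′
    i≢i′ = i′≢i ∘ sym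

    forget : Vec (Point d) h → Vec (Point d) h
    forget ρ = (ρ [ i′ ]≔ 𝟎) [ i ]≔ 𝟎

    Q′ : Vec (List (Point d)) h
    Q′ = (Q [ i′ ]≔ [ 𝟎 ]) [ i ]≔ [ 𝟎 ]

    fibre-∈ : ∀ {ρ} → ρ ∈ fibre → ρ ∈ choices Q × total ρ ≡ σ × lookup ρ i ≡ v
    fibre-∈ ρ∈ with ∈-filter⁻ (λ ρ → lookup ρ i ≟ₚ v) ρ∈
    ... | ρ∈′ , ρᵢ≡v with ∈-filter⁻ (λ ρ → total ρ ≟ₚ σ) ρ∈′
    ...   | ρ∈Q , Σρ≡σ = ρ∈Q , Σρ≡σ , ρᵢ≡v

    forget-∈ : ∀ {ρ} → ρ ∈ fibre → forget ρ ∈ choices Q′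
    forget-∈ {ρ} ρ∈ with fibre-∈ ρ∈
    ... | ρ∈Q , _ = ∈-choices⁺ Q′
      ([]≔-∈ (ρ [ i′ ]≔ 𝟎) (Q [ i′ ]≔ [ 𝟎 ]) i ([]≔-∈ ρ Q i′ (∈-choices⁻ Q ρ∈Q) (here refl)) (here refl))

    lookup-[]≔′ : ∀ ρ → lookup (ρ [ i′ ]≔ 𝟎) i ≡ lookup ρ i
    lookup-[]≔′ ρ = lookup∘update′ i≢i′ ρ 𝟎

    -- ρ is recovered from forget ρ: ρ i is fixed to v and ρ i′ is forced by the total σ
    forget-injective : ∀ {ρ ρ′} → ρ ∈ fibre → ρ′ ∈ fibre → forget ρ ≡ forget ρ′ → ρ ≡ ρ′
    forget-injective {ρ} {ρ′} ρ∈ ρ′∈ eq with fibre-∈ ρ∈ | fibre-∈ ρ′∈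
    ... | _ , Σρ≡σ , ρᵢ≡v | _ , Σρ′≡σ , ρ′ᵢ≡v = []≔-injective i′ same-rest same-i′
      where
      same-rest : ρ [ i′ ]≔ 𝟎 ≡ ρ′ [ i′ ]≔ 𝟎
      same-rest = []≔-injective i eq
        (trans (lookup-[]≔′ ρ) (trans ρᵢ≡v (trans (sym ρ′ᵢ≡v) (sym (lookup-[]≔′ ρ′)))))
      same-i′ : lookup ρ i′ ≡ lookup ρ′ i′
      same-i′ = +ₚ-cancelʳ _ _ (total (ρ [ i′ ]≔ 𝟎)) (begin
        lookup ρ i′ +ₚ total (ρ [ i′ ]≔ 𝟎)      ≡⟨ total-split ρ i′ ⟨
        total ρ                                   ≡⟨ trans Σρ≡σ (sym Σρ′≡σ) ⟩
        total ρ′                                  ≡⟨ total-split ρ′ i′ ⟩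
        lookup ρ′ i′ +ₚ total (ρ′ [ i′ ]≔ 𝟎)    ≡⟨ cong (λ ρ″ → lookup ρ′ i′ +ₚ total ρ″) same-rest ⟨
        lookup ρ′ i′ +ₚ total (ρ [ i′ ]≔ 𝟎)     ∎)
        where open ≡-Reasoning

    length-fibre : Unique (choices Q) → length fibre ≤ ∏length Q′
    length-fibre !Q = begin
      length fibre                 ≡⟨ length-map forget fibre ⟨
      length (map forget fibre)    ≤⟨ unique-⊆⇒length≤ (≡-dec _≟ₚ_) (unique-map⁺ forget-injective !fibre) forget⊆ ⟩
      length (choices Q′)          ≡⟨ length-choices Q′ ⟩
      ∏length Q′                   ∎
      where
      open ≤-Reasoning
      !fibre : Unique fibre
      !fibre = Unique.filter⁺ _ (Unique.filter⁺ _ !Q)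
      forget⊆ : ∀ {ρ″} → ρ″ ∈ map forget fibre → ρ″ ∈ choices Q′
      forget⊆ ρ″∈ with ∈-map⁻ forget ρ″∈
      ... | ρ , ρ∈ , refl = forget-∈ ρ∈

    ∏length-Q′ : ∏length Q′ * (length (lookup Q i) * length (lookup Q i′)) ≡ ∏length Q
    ∏length-Q′ = begin
      ∏length Q′ * (length (lookup Q i) * length (lookup Q i′))
        ≡⟨ *-assoc (∏length Q′) _ _ ⟨
      ∏length Q′ * length (lookup Q i) * length (lookup Q i′)
        ≡⟨ cong (λ L → ∏length Q′ * length L * length (lookup Q i′)) (lookup∘update′ i≢i′ Q [ 𝟎 ]) ⟨
      ∏length Q′ * length (lookup (Q [ i′ ]≔ [ 𝟎 ]) i) * length (lookup Q i′)
        ≡⟨ cong (_* length (lookup Q i′)) (∏length-[]≔-singleton (Q [ i′ ]≔ [ 𝟎 ]) i) ⟩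
      ∏length (Q [ i′ ]≔ [ 𝟎 ]) * length (lookup Q i′)
        ≡⟨ ∏length-[]≔-singleton Q i′ ⟩
      ∏length Q ∎
      where open ≡-Reasoning

  fibre-bound : Unique (choices Q) →
    count (λ ρ → lookup ρ i ≟ₚ v) (filter (λ ρ → total ρ ≟ₚ σ) (choices Q)) * (length (lookup Q i) * length (lookup Q i′))
      ≤ ∏length Q
  fibre-bound !Q = ≤-trans (*-monoˡ-≤ (length (lookup Q i) * length (lookup Q i′)) (length-fibre !Q)) (≤-reflexive ∏length-Q′)

-- Chains of rows with pairwise distinct entries

module Chains {A : Set} (_≟_ : DecidableEquality A) (h : ℕ) where

  Row : Set
  Row = Vec A h

  entry : ∀ {m} → Vec Row m → Fin m → Fin h → A
  entry t l i = lookup (lookup t l) i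

  Fresh : ∀ {m} → Vec Row m → Row → Set
  Fresh t ρ = ∀ l i → lookup ρ i ≢ entry t l i

  fresh? : ∀ {m} (t : Vec Row m) → Decidable (Fresh t)
  fresh? t ρ = all? λ l → all? λ i → ¬? (lookup ρ i ≟ entry t l i)

  chains : List Row → (m : ℕ) → List (Vec Row m)
  chains C zero    = [ [] ]
  chains C (suc m) = concatMap (λ t → map (_∷ t) (filter (fresh? t) C)) (chains C m)

  private
    chains-∷⁻ : ∀ {C m ρ t} → ρ ∷ t ∈ chains C (suc m) → t ∈ chains C m × ρ ∈ C × Fresh t ρ
    chains-∷⁻ {C} {m} {ρ} {t} ρ∷t∈ with find (∈-concatMap⁻ (λ t → map (_∷ t) (filter (fresh? t) C)) {xs = chains C m} ρ∷t∈)
    ... | t′ , t′∈ , ρ∷t∈′ with ∈-map⁻ (_∷ t′) ρ∷t∈′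
    ...   | ρ′ , ρ′∈ , refl with ∈-filter⁻ (fresh? t′) ρ′∈
    ...     | ρ∈C , fresh = t′∈ , ρ∈C , fresh

  chains-⊆ : ∀ {C m t} → t ∈ chains C m → ∀ l → lookup t l ∈ C
  chains-⊆ {m = suc m} {ρ ∷ t} t∈ fzero    = proj₁ (proj₂ (chains-∷⁻ t∈))
  chains-⊆ {m = suc m} {ρ ∷ t} t∈ (fsuc l) = chains-⊆ (proj₁ (chains-∷⁻ t∈)) l

  chains-disjoint : ∀ {C m t} → t ∈ chains C m → ∀ {l l′} i → l ≢ l′ → entry t l i ≢ entry t l′ i
  chains-disjoint {m = suc m} {ρ ∷ t} t∈ {fzero}  {fzero}   i l≢l′ = contradiction refl l≢l′
  chains-disjoint {m = suc m} {ρ ∷ t} t∈ {fzero}  {fsuc l′} i _    = proj₂ (proj₂ (chains-∷⁻ t∈)) l′ i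
  chains-disjoint {m = suc m} {ρ ∷ t} t∈ {fsuc l} {fzero}   i _    = proj₂ (proj₂ (chains-∷⁻ t∈)) l i ∘ sym
  chains-disjoint {m = suc m} {ρ ∷ t} t∈ {fsuc l} {fsuc l′} i l≢l′ =
    chains-disjoint (proj₁ (chains-∷⁻ t∈)) i (l≢l′ ∘ cong fsuc)

  chains-unique : ∀ {C} m → Unique C → Unique (chains C m)
  chains-unique zero    !C = [] ∷ []
  chains-unique {C} (suc m) !C =
    unique-concatMap⁺ (chains-unique m !C) (λ _ → Unique.map⁺ ∷-injectiveˡ (Unique.filter⁺ _ !C)) tails
    where
    tails : ∀ {t t′ y} → t ∈ chains C m → t′ ∈ chains C m →
            y ∈ map (_∷ t) (filter (fresh? t) C) → y ∈ map (_∷ t′) (filter (fresh? t′) C) → t ≡ t′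
    tails {t} {t′} _ _ y∈ y∈′ with ∈-map⁻ (_∷ t) y∈ | ∈-map⁻ (_∷ t′) y∈′
    ... | _ , _ , refl | _ , _ , eq = ∷-injectiveʳ eq

  module _ (C : List Row) (M : ℕ) (collisions≤M : ∀ i v → count (λ ρ → lookup ρ i ≟ v) C ≤ M) where

    stale≤ : ∀ {m} (t : Vec Row m) → count (∁? (fresh? t)) C ≤ m * (h * M)
    stale≤ {m} t = begin
      count (∁? (fresh? t)) C
        ≤⟨ count-mono (∁? (fresh? t)) collision? C (λ {ρ} _ → collision {ρ}) ⟩
      count collision? C
        ≤⟨ count-∃ m _ C (λ l → count-∃ h _ C (λ i → collisions≤M i (entry t l i))) ⟩
      m * (h * M) ∎
      where
      open ≤-Reasoning
      collision? = λ ρ → any? λ l → any? λ i → lookup ρ i ≟ entry t l i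
      collision : ∀ {ρ} → ¬ Fresh t ρ → ∃ λ l → ∃ λ i → lookup ρ i ≡ entry t l i
      collision {ρ} stale with ¬∀⟶∃¬ m _ (λ l → all? λ i → ¬? (lookup ρ i ≟ entry t l i)) stale
      ... | l , ¬fresh-l with ¬∀⟶∃¬ h _ (λ i → ¬? (lookup ρ i ≟ entry t l i)) ¬fresh-l
      ...   | i , ¬¬eq = l , i , decidable-stable (lookup ρ i ≟ entry t l i) ¬¬eq

    -- each extension of a chain of length m ≤ k misses at most k h M rows of C
    length-chains : ∀ k m → m ≤ k → (length C ∸ k * (h * M)) ^ m ≤ length (chains C m)
    length-chains k zero    _   = ≤-refl
    length-chains k (suc m) m<k = begin
      (length C ∸ k * (h * M)) ^ suc m
        ≡⟨ *-comm (length C ∸ k * (h * M)) _ ⟩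
      (length C ∸ k * (h * M)) ^ m * (length C ∸ k * (h * M))
        ≤⟨ *-monoˡ-≤ _ (length-chains k m (<⇒≤ m<k)) ⟩
      length (chains C m) * (length C ∸ k * (h * M))
        ≡⟨ sum-map-const _ (chains C m) ⟨
      sum (map (λ _ → length C ∸ k * (h * M)) (chains C m))
        ≤⟨ sum-map-mono (chains C m) (λ {t} _ → extensions t) ⟩
      sum (map (length ∘ λ t → map (_∷ t) (filter (fresh? t) C)) (chains C m))
        ≡⟨ length-concatMap _ (chains C m) ⟨
      length (chains C (suc m)) ∎
      where
      open ≤-Reasoning
      extensions : ∀ (t : Vec Row m) → length C ∸ k * (h * M) ≤ length (map (_∷ t) (filter (fresh? t) C))
      extensions t = begin
        length C ∸ k * (h * M)                      ≤⟨ ∸-monoʳ-≤ (length C) (*-monoˡ-≤ (h * M) (<⇒≤ m<k)) ⟩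
        length C ∸ m * (h * M)                      ≤⟨ length∸≤count (fresh? t) C (stale≤ t) ⟩
        count (fresh? t) C                          ≡⟨ length-map (_∷ t) (filter (fresh? t) C) ⟨
        length (map (_∷ t) (filter (fresh? t) C))   ∎

-- Rows built from blocks

other-index : ∀ {h} → 2 ≤ h → (i : Fin h) → ∃ λ i′ → i′ ≢ i
other-index {suc (suc h)} _ fzero    = fsuc fzero , λ ()
other-index {suc (suc h)} _ (fsuc i) = fzero , λ ()
other-index {suc zero}    (s≤s ()) _

lookup-total≤ : ∀ {d h} n (ρ : Vec (Point d) h) → (∀ a → InGrid n (lookup ρ a)) → ∀ c → lookup (total ρ) c ≤ h * n
lookup-total≤ n []      _      c = ≤-reflexive (lookup-replicate c 0)
lookup-total≤ {h = suc h} n (x ∷ ρ) ρ∈grid c = begin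
  lookup (x +ₚ total ρ) c              ≡⟨ lookup-zipWith _+_ c x (total ρ) ⟩
  lookup x c + lookup (total ρ) c      ≤⟨ +-mono-≤ (proj₂ (lookup⁺ (ρ∈grid fzero) c)) (lookup-total≤ n ρ (ρ∈grid ∘ fsuc) c) ⟩
  n + h * n                            ∎
  where open ≤-Reasoning

module Rows {d n h : ℕ} (k₀ : ℕ) (Q : Vec (List (Point d)) h) (μ : ℕ)
  (Q-unique : ∀ i → Unique (lookup Q i))
  (Q-grid : ∀ i {x} → x ∈ lookup Q i → InGrid n x)
  (μ≤Q : ∀ i → μ ≤ length (lookup Q i))
  (2≤h : 2 ≤ h)
  (N≪μ² : 4 * suc k₀ * h * suc (h * n) ^ d ≤ μ * μ) where

  k : ℕ
  k = suc k₀

  rows : List (Vec (Point d) h)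
  rows = choices Q

  R : ℕ
  R = ∏length Q

  rows-unique : Unique rows
  rows-unique = choices-unique Q Q-unique

  coordinateRanges : Vec (List ℕ) d
  coordinateRanges = replicate d (upTo (suc (h * n)))

  box : List (Point d)
  box = choices coordinateRanges

  N : ℕ
  N = suc (h * n) ^ d

  instance
    N≢0 : NonZero N
    N≢0 = m^n≢0 (suc (h * n)) d
    h≢0 : NonZero h
    h≢0 = >-nonZero (≤-trans (s≤s z≤n) 2≤h)
    4N≢0 : NonZero (4 * N)
    4N≢0 = m*n≢0 4 N
    4khN≢0 : NonZero (4 * k * h * N)
    4khN≢0 = m*n≢0 (4 * k * h) N {{m*n≢0 (4 * k) h}}

  length-box : length box ≡ N
  length-box = trans (length-choices coordinateRanges)
    (∏length-uniform coordinateRanges (suc (h * n)) (λ c → trans (cong length (lookup-replicate c _)) (length-upTo _)))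

  box-unique : Unique box
  box-unique = choices-unique coordinateRanges (λ c → subst Unique (sym (lookup-replicate c _)) (Unique.upTo⁺ _))

  total-∈-box : ∀ {ρ} → ρ ∈ rows → total ρ ∈ box
  total-∈-box {ρ} ρ∈ = ∈-choices⁺ coordinateRanges λ c → subst (lookup (total ρ) c ∈_) (sym (lookup-replicate c _))
    (∈-upTo⁺ (s≤s (lookup-total≤ n ρ (λ a → Q-grid a (∈-choices⁻ Q ρ∈ a)) c)))

  withTotal : Point d → List (Vec (Point d) h)
  withTotal σ = filter (λ ρ → total ρ ≟ₚ σ) rows

  M : ℕ
  M = R / (4 * k * h * N)

  collisions≤M : ∀ σ i v → count (λ ρ → lookup ρ i ≟ₚ v) (withTotal σ) ≤ M
  collisions≤M σ i v = m*n≤o⇒m≤o/n collisions (4 * k * h * N) R (begin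
    collisions * (4 * k * h * N)                                   ≤⟨ *-monoʳ-≤ collisions N≪μ² ⟩
    collisions * (μ * μ)                                           ≤⟨ *-monoʳ-≤ collisions (*-mono-≤ (μ≤Q i) (μ≤Q i′)) ⟩
    collisions * (length (lookup Q i) * length (lookup Q i′))     ≤⟨ fibre-bound Q i′≢i σ v rows-unique ⟩
    R                                                              ∎)
    where
    open ≤-Reasoning
    collisions = count (λ ρ → lookup ρ i ≟ₚ v) (withTotal σ)
    i′ = proj₁ (other-index 2≤h i)
    i′≢i = proj₂ (other-index 2≤h i)

  open Chains (_≟ₚ_ {d}) h public

  G : List (Vec Row k)
  G = concatMap (λ σ → chains (withTotal σ) k) box

  G-chain : ∀ {t} → t ∈ G → ∃ λ σ → t ∈ chains (withTotal σ) k
  G-chain t∈ with find (∈-concatMap⁻ (λ σ → chains (withTotal σ) k) {xs = box} t∈)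
  ... | σ , _ , t∈′ = σ , t∈′

  private
    withTotal-∈ : ∀ {σ ρ} → ρ ∈ withTotal σ → ρ ∈ rows × total ρ ≡ σ
    withTotal-∈ {σ} = ∈-filter⁻ (λ ρ → total ρ ≟ₚ σ)

  G-entries : ∀ {t} → t ∈ G → ∀ l i → entry t l i ∈ lookup Q i
  G-entries t∈ l = ∈-choices⁻ Q (proj₁ (withTotal-∈ (chains-⊆ (proj₂ (G-chain t∈)) l)))

  G-totals : ∀ {t} → t ∈ G → ∀ l l′ → total (lookup t l) ≡ total (lookup t l′)
  G-totals t∈ l l′ with G-chain t∈
  ... | σ , t∈′ = trans (proj₂ (withTotal-∈ (chains-⊆ t∈′ l))) (sym (proj₂ (withTotal-∈ (chains-⊆ t∈′ l′))))

  G-disjoint : ∀ {t} → t ∈ G → ∀ {l l′} i → l ≢ l′ → entry t l i ≢ entry t l′ i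
  G-disjoint t∈ = chains-disjoint (proj₂ (G-chain t∈))

  G-unique : Unique G
  G-unique = unique-concatMap⁺ box-unique (λ _ → chains-unique k (Unique.filter⁺ _ rows-unique)) same-total
    where
    totalOf : ∀ {σ t} → t ∈ chains (withTotal σ) k → total (lookup t fzero) ≡ σ
    totalOf t∈ = proj₂ (withTotal-∈ (chains-⊆ t∈ fzero))
    same-total : ∀ {σ σ′ t} → σ ∈ box → σ′ ∈ box →
                 t ∈ chains (withTotal σ) k → t ∈ chains (withTotal σ′) k → σ ≡ σ′
    same-total _ _ t∈ t∈′ = trans (sym (totalOf t∈)) (totalOf t∈′)

  T : ℕ
  T = R / (4 * N)

  D : ℕ
  D = k * (h * M)

  length-G≥ : T ^ k₀ * (R ∸ N * (D + T)) ≤ length G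
  length-G≥ = begin
    T ^ k₀ * (R ∸ N * (D + T))
      ≤⟨ *-monoʳ-≤ (T ^ k₀) (∸-monoˡ-≤ (N * (D + T)) R≤∑) ⟩
    T ^ k₀ * (sum (map (length ∘ withTotal) box) ∸ N * (D + T))
      ≡⟨ cong (λ x → T ^ k₀ * (sum (map (length ∘ withTotal) box) ∸ x * (D + T))) length-box ⟨
    T ^ k₀ * (sum (map (length ∘ withTotal) box) ∸ length box * (D + T))
      ≤⟨ *-monoʳ-≤ (T ^ k₀) (sum-map-∸ (length ∘ withTotal) (D + T) box) ⟩
    T ^ k₀ * sum (map (λ σ → length (withTotal σ) ∸ (D + T)) box)
      ≡⟨ sum-map-*ˡ (T ^ k₀) (λ σ → length (withTotal σ) ∸ (D + T)) box ⟨
    sum (map (λ σ → T ^ k₀ * (length (withTotal σ) ∸ (D + T))) box)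
      ≤⟨ sum-map-mono box (λ {σ} _ → chains-per-total σ) ⟩
    sum (map (length ∘ λ σ → chains (withTotal σ) k) box)
      ≡⟨ length-concatMap (λ σ → chains (withTotal σ) k) box ⟨
    length G ∎
    where
    open ≤-Reasoning
    R≤∑ : R ≤ sum (map (length ∘ withTotal) box)
    R≤∑ = begin
      R                                      ≡⟨ length-choices Q ⟨
      length rows                            ≤⟨ length≤sum-count (λ σ ρ → total ρ ≟ₚ σ) box rows
                                                  (λ {ρ} ρ∈ → total ρ , total-∈-box ρ∈ , refl) ⟩
      sum (map (length ∘ withTotal) box)     ∎
    chains-per-total : ∀ σ → T ^ k₀ * (length (withTotal σ) ∸ (D + T)) ≤ length (chains (withTotal σ) k)
    chains-per-total σ = begin
      T ^ k₀ * (length (withTotal σ) ∸ (D + T))   ≡⟨ cong (T ^ k₀ *_) (∸-+-assoc (length (withTotal σ)) D T) ⟨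
      T ^ k₀ * (length (withTotal σ) ∸ D ∸ T)     ≤⟨ t^k*[x∸t]≤x^[1+k] (length (withTotal σ) ∸ D) T k₀ ⟩
      (length (withTotal σ) ∸ D) ^ k              ≤⟨ length-chains (withTotal σ) M (collisions≤M σ) k k ≤-refl ⟩
      length (chains (withTotal σ) k)             ∎

  private
    μ≢0 : NonZero μ
    μ≢0 = m*n≢0⇒m≢0 μ {{>-nonZero (≤-trans (>-nonZero⁻¹ (4 * k * h * N)) N≪μ²)}}

    4N≤R : 4 * N ≤ R
    4N≤R = begin
      4 * N               ≤⟨ *-monoˡ-≤ N (subst (4 ≤_) (sym (*-assoc 4 k h)) (m≤m*n 4 (k * h) {{m*n≢0 k h}})) ⟩
      4 * k * h * N       ≤⟨ N≪μ² ⟩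
      μ * μ               ≡⟨ cong (μ *_) (*-identityʳ μ) ⟨
      μ ^ 2               ≤⟨ ^-monoʳ-≤ μ {{μ≢0}} 2≤h ⟩
      μ ^ h               ≤⟨ ^≤∏length Q μ≤Q ⟩
      R                   ∎
      where open ≤-Reasoning

    2N[D+T]≤R : 2 * (N * (D + T)) ≤ R
    2N[D+T]≤R = *-cancelˡ-≤ 2 (begin
      2 * (2 * (N * (D + T)))       ≡⟨ expand k h M N T ⟩
      M * (4 * k * h * N) + T * (4 * N) ≤⟨ +-mono-≤ (m/n*n≤m R (4 * k * h * N)) (m/n*n≤m R (4 * N)) ⟩
      R + R                         ≡⟨ cong (R +_) (+-identityʳ R) ⟨
      2 * R                         ∎)
      where
      open ≤-Reasoning
      expand : ∀ k h M N T → 2 * (2 * (N * (k * (h * M) + T))) ≡ M * (4 * k * h * N) + T * (4 * N)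
      expand = solve-∀

    R≤8NT : R ≤ 8 * N * T
    R≤8NT = subst (R ≤_) (cong (_* T) (sym (*-assoc 2 4 N))) (m≤2*n*[m/n] R (4 * N) 4N≤R)

  R^k≤ : R ^ k ≤ 2 * (8 * N) ^ k₀ * length G
  R^k≤ = begin
    R * R ^ k₀                                          ≤⟨ *-mono-≤ (m≤2*[m∸n] R (N * (D + T)) 2N[D+T]≤R) (^-monoˡ-≤ k₀ R≤8NT) ⟩
    2 * (R ∸ N * (D + T)) * (8 * N * T) ^ k₀            ≡⟨ cong (2 * (R ∸ N * (D + T)) *_) (^-distribʳ-* (8 * N) T k₀) ⟩
    2 * (R ∸ N * (D + T)) * ((8 * N) ^ k₀ * T ^ k₀)     ≡⟨ rearrange (R ∸ N * (D + T)) ((8 * N) ^ k₀) (T ^ k₀) ⟩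
    2 * (8 * N) ^ k₀ * (T ^ k₀ * (R ∸ N * (D + T)))     ≤⟨ *-monoʳ-≤ (2 * (8 * N) ^ k₀) length-G≥ ⟩
    2 * (8 * N) ^ k₀ * length G                         ∎
    where
    open ≤-Reasoning
    rearrange : ∀ x y z → 2 * x * (y * z) ≡ 2 * y * (z * x)
    rearrange = solve-∀

-- Families up to their underlying set

module _ {A : Set} {R : Rel A 0ℓ} where

  allPairs-lookup-injective : Symmetric R → ∀ {xs} → AllPairs (λ x y → ¬ R x y) xs →
                              ∀ a b → R (List.lookup xs a) (List.lookup xs b) → a ≡ b
  allPairs-lookup-injective R-sym (_  ∷ _)   fzero    fzero    _ = refl
  allPairs-lookup-injective R-sym (≉x ∷ _)   fzero    (fsuc b) r = contradiction r (All.lookup ≉x (∈-lookup b))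
  allPairs-lookup-injective R-sym (≉x ∷ _)   (fsuc a) fzero    r = contradiction (R-sym r) (All.lookup ≉x (∈-lookup a))
  allPairs-lookup-injective R-sym (_  ∷ ≉xs) (fsuc a) (fsuc b) r = cong fsuc (allPairs-lookup-injective R-sym ≉xs a b r)

module _ {d k h : ℕ} where

  -- Similar x y is a decidable equivalent of SameSet x y
  Covers : Config k h d → Config k h d → Set
  Covers x y = ∀ l i → ∃ λ l′ → ∃ λ i′ → x l i ≡ y l′ i′

  covers? : B.Decidable Covers
  covers? x y = all? λ l → all? λ i → any? λ l′ → any? λ i′ → x l i ≟ₚ y l′ i′

  covers-refl : ∀ x → Covers x x
  covers-refl x l i = l , i , refl

  covers-trans : ∀ {x y z} → Covers x y → Covers y z → Covers x z
  covers-trans x⊆y y⊆z l i with x⊆y l i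
  ... | l′ , i′ , eq with y⊆z l′ i′
  ...   | l″ , i″ , eq′ = l″ , i″ , trans eq eq′

  Similar : Config k h d → Config k h d → Set
  Similar x y = Covers x y × Covers y x

  sameSet⇒similar : ∀ {x y} → SameSet x y → Similar x y
  sameSet⇒similar {x} {y} same = to-covers , from-covers
    where
    to-covers : Covers x y
    to-covers l i with Equivalence.to (same (x l i)) (l , i , refl)
    ... | l′ , i′ , eq = l′ , i′ , sym eq
    from-covers : Covers y x
    from-covers l i with Equivalence.from (same (y l i)) (l , i , refl)
    ... | l′ , i′ , eq = l′ , i′ , sym eq

module Representatives {d k h} (Q : Vec (List (Point d)) h) (Q-disjoint : PairwiseDisjoint Q)
  (G : List (Vec (Vec (Point d) h) k)) (G-unique : Unique G)
  (G-entries : ∀ {t} → t ∈ G → ∀ l i → lookup (lookup t l) i ∈ lookup Q i) where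

  Tuple : Set
  Tuple = Vec (Vec (Point d) h) k

  configuration : Tuple → Config k h d
  configuration t l i = lookup (lookup t l) i

  _≈_ : Tuple → Tuple → Set
  _≈_ = Similar on configuration

  similar? : B.Decidable _≈_
  similar? t u = covers? (configuration t) (configuration u) ×-dec covers? (configuration u) (configuration t)

  ≈-sym : ∀ {t u} → t ≈ u → u ≈ t
  ≈-sym (t⊆u , u⊆t) = u⊆t , t⊆u

  ≈-trans : ∀ {t u v} → t ≈ u → u ≈ v → t ≈ v
  ≈-trans {t} {u} {v} (t⊆u , u⊆t) (u⊆v , v⊆u) =
    covers-trans {x = configuration t} t⊆u u⊆v , covers-trans {x = configuration v} v⊆u u⊆t

  similarity : DecSetoid _ _
  similarity = record
    { Carrier = Tuple
    ; _≈_ = _≈_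
    ; isDecEquivalence = record
      { isEquivalence = record
        { refl  = λ {t} → covers-refl (configuration t) , covers-refl (configuration t)
        ; sym   = λ {t} {u} → ≈-sym {t} {u}
        ; trans = λ {t} {u} {v} → ≈-trans {t} {u} {v}
        }
      ; _≟_ = similar?
      }
    }

  reps : List Tuple
  reps = deduplicate similar? G

  reps-⊆ : ∀ {t} → t ∈ reps → t ∈ G
  reps-⊆ = ∈-deduplicate⁻ similar? G

  reps-cover : ∀ {t} → t ∈ G → ∃ λ u → u ∈ reps × u ≈ t
  reps-cover {t} t∈ = find (deduplicate⁺ similar? (λ {v} {u} u≈v v≈t → ≈-trans {u} {v} {t} u≈v v≈t)
    (Any.map (λ { refl → DecSetoid.refl similarity {t} }) t∈))

  reps-distinct : ∀ a b → SameSet (configuration (List.lookup reps a)) (configuration (List.lookup reps b)) → a ≡ b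
  reps-distinct a b same =
    allPairs-lookup-injective (λ {t} {u} → ≈-sym {t} {u}) (deduplicate-! similarity G) a b (sameSet⇒similar same)

  K : ℕ
  K = (k ^ h) ^ k

  private
    column : Tuple → Fin h → List (Point d)
    column t i = List.tabulate (λ l → configuration t l i)

    columns : Tuple → Vec (List (Point d)) h
    columns t = tabulate (column t)

    -- every tuple similar to t is built from the entries of t, column by column
    rearrangements : Tuple → List Tuple
    rearrangements t = choices (replicate k (choices (columns t)))

    length-rearrangements : ∀ t → length (rearrangements t) ≡ K
    length-rearrangements t = trans (length-choices (replicate k (choices (columns t))))
      (∏length-uniform (replicate k (choices (columns t))) (k ^ h) λ l → trans (cong length (lookup-replicate l (choices (columns t))))
        (trans (length-choices (columns t))
          (∏length-uniform (columns t) k λ i → trans (cong length (lookup∘tabulate (column t) i)) (length-tabulate _))))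

    similar-∈-rearrangements : ∀ {t u} → t ∈ G → u ∈ G → t ≈ u → u ∈ rearrangements t
    similar-∈-rearrangements {t} {u} t∈ u∈ (_ , u⊆t) =
      ∈-choices⁺ (replicate k (choices (columns t))) λ l → subst (lookup u l ∈_) (sym (lookup-replicate l _))
        (∈-choices⁺ (columns t) λ i → subst (configuration u l i ∈_) (sym (lookup∘tabulate (column t) i)) (entry∈column l i))
      where
      entry∈column : ∀ l i → configuration u l i ∈ column t i
      entry∈column l i with u⊆t l i
      ... | l′ , i′ , eq with Q-disjoint i′ i (subst (_∈ lookup Q i′) (sym eq) (G-entries t∈ l′ i′)) (G-entries u∈ l i)
      ...   | refl = subst (_∈ column t i) (sym eq) (∈-tabulate⁺ l′)

  class-size : ∀ {t} → t ∈ G → count (similar? t) G ≤ K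
  class-size {t} t∈ = begin
    count (similar? t) G       ≤⟨ unique-⊆⇒length≤ (≡-dec (≡-dec _≟ₚ_)) (Unique.filter⁺ (similar? t) G-unique) class⊆ ⟩
    length (rearrangements t)  ≡⟨ length-rearrangements t ⟩
    K                          ∎
    where
    open ≤-Reasoning
    class⊆ : ∀ {u} → u ∈ filter (similar? t) G → u ∈ rearrangements t
    class⊆ u∈ with ∈-filter⁻ (similar? t) u∈
    ... | u∈G , t≈u = similar-∈-rearrangements t∈ u∈G t≈u

  length-G≤ : length G ≤ length reps * K
  length-G≤ = begin
    length G                                         ≤⟨ length≤sum-count similar? reps G reps-cover ⟩
    sum (map (λ u → count (similar? u) G) reps)      ≤⟨ sum-map-mono reps (class-size ∘ reps-⊆) ⟩
    sum (map (λ _ → K) reps)                         ≡⟨ sum-map-const K reps ⟩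
    length reps * K                                  ∎
    where open ≤-Reasoning

module Construction {d n} (k₀ j e : ℕ) {A₁ A₂ : List (Point d)} {w₁ w₂ μ : ℕ}
  (!A₁ : Unique A₁) (!A₂ : Unique A₂) (A₁∩A₂=∅ : Disjoint A₁ A₂)
  (A₁-grid : All (InGrid n) A₁) (A₂-grid : All (InGrid n) A₂)
  (jw₁≤ : j * w₁ ≤ length A₁) (ew₂≤ : e * w₂ ≤ length A₂)
  (2≤h : 2 ≤ j + e) (μ≤w₁ : μ ≤ w₁) (μ≤w₂ : μ ≤ w₂)
  (N≪μ² : 4 * suc k₀ * (j + e) * suc ((j + e) * n) ^ d ≤ μ * μ) where

  h : ℕ
  h = j + e

  Q : Vec (List (Point d)) h
  Q = chunks j w₁ A₁ ++ᵥ chunks e w₂ A₂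

  Q-unique : ∀ i → Unique (lookup Q i)
  Q-unique i with lookup-++-cases (chunks j w₁ A₁) (chunks e w₂ A₂) i
  ... | inj₁ (_ , p , eq) = subst Unique (sym eq) (chunks-unique j w₁ !A₁ p)
  ... | inj₂ (_ , q , eq) = subst Unique (sym eq) (chunks-unique e w₂ !A₂ q)

  Q-disjoint : PairwiseDisjoint Q
  Q-disjoint = ++-pairwiseDisjoint (chunks j w₁ A₁) (chunks e w₂ A₂) (chunks-disjoint j w₁ !A₁) (chunks-disjoint e w₂ !A₂)
    (λ p q x∈ x∈′ → A₁∩A₂=∅ _ (chunks-⊆ j w₁ p x∈) (chunks-⊆ e w₂ q x∈′))

  Q-⊆A₁ : ∀ i {x} → toℕ i < j → x ∈ lookup Q i → x ∈ A₁
  Q-⊆A₁ i {x} i<j x∈ with lookup-++-cases (chunks j w₁ A₁) (chunks e w₂ A₂) i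
  ... | inj₁ (_ , p , eq)   = chunks-⊆ j w₁ p (subst (x ∈_) eq x∈)
  ... | inj₂ (j≤i , _ , _) = contradiction i<j (≤⇒≯ j≤i)

  Q-⊆A₂ : ∀ i {x} → j ≤ toℕ i → x ∈ lookup Q i → x ∈ A₂
  Q-⊆A₂ i {x} j≤i x∈ with lookup-++-cases (chunks j w₁ A₁) (chunks e w₂ A₂) i
  ... | inj₁ (i<j , _ , _) = contradiction i<j (≤⇒≯ j≤i)
  ... | inj₂ (_ , q , eq)   = chunks-⊆ e w₂ q (subst (x ∈_) eq x∈)

  Q-grid : ∀ i {x} → x ∈ lookup Q i → InGrid n x
  Q-grid i {x} x∈ with lookup-++-cases (chunks j w₁ A₁) (chunks e w₂ A₂) i
  ... | inj₁ (_ , p , eq) = All.lookup A₁-grid (chunks-⊆ j w₁ p (subst (x ∈_) eq x∈))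
  ... | inj₂ (_ , q , eq) = All.lookup A₂-grid (chunks-⊆ e w₂ q (subst (x ∈_) eq x∈))

  μ≤Q : ∀ i → μ ≤ length (lookup Q i)
  μ≤Q i with lookup-++-cases (chunks j w₁ A₁) (chunks e w₂ A₂) i
  ... | inj₁ (_ , p , eq) = subst (μ ≤_) (sym (trans (cong length eq) (length-chunks j w₁ jw₁≤ p))) μ≤w₁
  ... | inj₂ (_ , q , eq) = subst (μ ≤_) (sym (trans (cong length eq) (length-chunks e w₂ ew₂≤ q))) μ≤w₂

  ∏length-Q : ∏length Q ≡ w₁ ^ j * w₂ ^ e
  ∏length-Q = trans (∏length-++ (chunks j w₁ A₁) (chunks e w₂ A₂))
    (cong₂ _*_ (∏length-uniform (chunks j w₁ A₁) w₁ (length-chunks j w₁ jw₁≤))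
                (∏length-uniform (chunks e w₂ A₂) w₂ (length-chunks e w₂ ew₂≤)))

  open Rows k₀ Q μ Q-unique Q-grid μ≤Q 2≤h N≪μ²
  open Representatives Q Q-disjoint G G-unique G-entries

  admissible : ∀ a → Admissible k h j A₁ A₂ (configuration (List.lookup reps a))
  admissible a =
    distinct , (λ l i i<j → Q-⊆A₁ i i<j (entries l i)) , (λ l i j≤i → Q-⊆A₂ i j≤i (entries l i)) , G-totals t∈G
    where
    t = List.lookup reps a
    t∈G = reps-⊆ (∈-lookup a)
    entries = G-entries t∈G
    distinct : ∀ l i l′ i′ → configuration t l i ≡ configuration t l′ i′ → l ≡ l′ × i ≡ i′
    distinct l i l′ i′ eq with Q-disjoint i i′ (entries l i) (subst (_∈ lookup Q i′) (sym eq) (entries l′ i′))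
    ... | refl with l Fin.≟ l′
    ...   | yes l≡l′ = l≡l′ , refl
    ...   | no l≢l′  = contradiction eq (G-disjoint t∈G i l≢l′)

  configurations : Σ ℕ λ m → fAtLeast k h j A₁ A₂ m × ((w₁ ^ j * w₂ ^ e) ^ k ≤ 2 * (8 * N) ^ k₀ * (m * K))
  configurations = length reps , ((λ a → configuration (List.lookup reps a)) , admissible , reps-distinct)
                 , subst (λ r → r ^ k ≤ 2 * (8 * N) ^ k₀ * (length reps * K)) ∏length-Q
                     (≤-trans R^k≤ (*-monoʳ-≤ (2 * (8 * N) ^ k₀) length-G≤))

-- Choice of parameters

P²nᵈ≤s² : ∀ d k₀ {P n s} .{{_ : NonZero n}} → 1 ≤ k₀ → 2 ^ P < n → LogBound d (suc k₀) n s → P * P * n ^ d ≤ s * s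
P²nᵈ≤s² d k₀ {P} {n} {s} 1≤k₀ 2ᴾ<n large = ^-cancelˡ-≤ k (begin
  (P * P * n ^ d) ^ k                      ≡⟨ trans (^-distribʳ-* (P * P) (n ^ d) k) (cong₂ _*_ (^-distribʳ-* P P k) (^-*-assoc n d k)) ⟩
  Pᵏ * Pᵏ * n ^ (d * k)                    ≤⟨ *-monoʳ-≤ (Pᵏ * Pᵏ) (^-monoʳ-≤ n d[1+k₀]≤2k₀d) ⟩
  Pᵏ * Pᵏ * n ^ (k₀ * d + k₀ * d)          ≡⟨ cong (Pᵏ * Pᵏ *_) (^-distribˡ-+-* n (k₀ * d) (k₀ * d)) ⟩
  Pᵏ * Pᵏ * (n ^ (k₀ * d) * n ^ (k₀ * d))  ≡⟨ *-interchange Pᵏ Pᵏ (n ^ (k₀ * d)) (n ^ (k₀ * d)) ⟩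
  Pᵏ * n ^ (k₀ * d) * (Pᵏ * n ^ (k₀ * d))  ≤⟨ *-mono-≤ Pᵏnᵏ⁻¹ᵈ≤sᵏ Pᵏnᵏ⁻¹ᵈ≤sᵏ ⟩
  s ^ k * s ^ k                            ≡⟨ ^-distribʳ-* s s k ⟨
  (s * s) ^ k                              ∎)
  where
  open ≤-Reasoning
  k = suc k₀
  Pᵏ = P ^ k
  -- LogBound at the rational P/1, which lies below log₂ n
  Pᵏnᵏ⁻¹ᵈ≤sᵏ : Pᵏ * n ^ (k₀ * d) ≤ s ^ k
  Pᵏnᵏ⁻¹ᵈ≤sᵏ = subst (Pᵏ * n ^ (k₀ * d) ≤_) (trans (cong (_* s ^ k) (^-zeroˡ k)) (*-identityˡ (s ^ k)))
    (large P 1 (s≤s z≤n) (subst (2 ^ P <_) (sym (*-identityʳ n)) 2ᴾ<n))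
  d[1+k₀]≤2k₀d : d * k ≤ k₀ * d + k₀ * d
  d[1+k₀]≤2k₀d = begin
    d * k            ≡⟨ *-comm d k ⟩
    d + k₀ * d       ≤⟨ +-monoˡ-≤ (k₀ * d) (subst (_≤ k₀ * d) (*-identityˡ d) (*-monoˡ-≤ d 1≤k₀)) ⟩
    k₀ * d + k₀ * d  ∎

[1+hn]ᵈ≤[2h]ᵈnᵈ : ∀ d h n .{{_ : NonZero h}} .{{_ : NonZero n}} → suc (h * n) ^ d ≤ (2 * h) ^ d * n ^ d
[1+hn]ᵈ≤[2h]ᵈnᵈ d h n = begin
  suc (h * n) ^ d       ≤⟨ ^-monoˡ-≤ d (+-monoˡ-≤ (h * n) (>-nonZero⁻¹ (h * n) {{m*n≢0 h n}})) ⟩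
  (h * n + h * n) ^ d   ≡⟨ cong (_^ d) (double h n) ⟩
  (2 * h * n) ^ d       ≡⟨ ^-distribʳ-* (2 * h) n d ⟩
  (2 * h) ^ d * n ^ d   ∎
  where
  open ≤-Reasoning
  double : ∀ h n → h * n + h * n ≡ 2 * h * n
  double = solve-∀

-- once log₂ n > threshold d k h, blocks of size about |A|/h satisfy 4kh(hn + 1)^d ≤ w²
threshold : ℕ → ℕ → ℕ → ℕ
threshold d k h = 16 * h * h * (k * h * (2 * h) ^ d)

h*h≤threshold : ∀ d k h .{{_ : NonZero k}} .{{_ : NonZero h}} → h * h ≤ threshold d k h
h*h≤threshold d k h = begin
  h * h                                 ≤⟨ m≤n*m (h * h) 16 ⟩
  16 * (h * h)                          ≤⟨ m≤m*n (16 * (h * h)) (k * h * (2 * h) ^ d) {{khX≢0}} ⟩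
  16 * (h * h) * (k * h * (2 * h) ^ d)  ≡⟨ cong (_* (k * h * (2 * h) ^ d)) (*-assoc 16 h h) ⟨
  threshold d k h                       ∎
  where
  open ≤-Reasoning
  khX≢0 : NonZero (k * h * (2 * h) ^ d)
  khX≢0 = m*n≢0 (k * h) _ {{m*n≢0 k h}} {{m^n≢0 (2 * h) d {{m*n≢0 2 h}}}}

private
  square-cancel : ∀ {m n} → m * m ≤ n * n → m ≤ n
  square-cancel {m} {n} m²≤n² =
    ^-cancelˡ-≤ 2 (subst₂ _≤_ (cong (m *_) (sym (*-identityʳ m))) (cong (n *_) (sym (*-identityʳ n))) m²≤n²)

blockSize : ∀ {s n} d k {c h} .{{_ : NonZero n}} .{{_ : NonZero k}} → 1 ≤ c → c ≤ h →
  threshold d k h * threshold d k h * n ^ d ≤ s * s →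
  Σ ℕ λ w → (c * w ≤ s) × (s ≤ 2 * c * w) × (4 * k * h * suc (h * n) ^ d ≤ w * w)
blockSize {s} {n} d k {c} {h} 1≤c c≤h P²nᵈ≤s² = s / c , cw≤s , s≤2cw , N≪w²
  where
  open ≤-Reasoning
  P = threshold d k h
  instance
    c≢0 : NonZero c
    c≢0 = >-nonZero 1≤c
    h≢0 : NonZero h
    h≢0 = >-nonZero (≤-trans 1≤c c≤h)
    2c≢0 : NonZero (2 * c * (2 * c))
    2c≢0 = m*n≢0 (2 * c) (2 * c) {{m*n≢0 2 c}} {{m*n≢0 2 c}}
    nᵈ≢0 : NonZero (n ^ d)
    nᵈ≢0 = m^n≢0 n d
    hh≢0 : NonZero (h * h)
    hh≢0 = m*n≢0 h h
    P≢0 : NonZero P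
    P≢0 = >-nonZero (≤-trans (>-nonZero⁻¹ (h * h)) (h*h≤threshold d k h))
  Pnᵈ≤s² : P * n ^ d ≤ s * s
  Pnᵈ≤s² = ≤-trans (*-monoˡ-≤ (n ^ d) (m≤m*n P P)) P²nᵈ≤s²
  c≤s : c ≤ s
  c≤s = square-cancel (begin
    c * c          ≤⟨ *-mono-≤ c≤h c≤h ⟩
    h * h          ≤⟨ h*h≤threshold d k h ⟩
    P              ≤⟨ m≤m*n P (n ^ d) ⟩
    P * n ^ d      ≤⟨ Pnᵈ≤s² ⟩
    s * s          ∎)
  cw≤s : c * (s / c) ≤ s
  cw≤s = subst (_≤ s) (*-comm (s / c) c) (m/n*n≤m s c)
  s≤2cw : s ≤ 2 * c * (s / c)
  s≤2cw = m≤2*n*[m/n] s c c≤s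
  N≪w² : 4 * k * h * suc (h * n) ^ d ≤ s / c * (s / c)
  N≪w² = *-cancelˡ-≤ (2 * c * (2 * c)) (begin
    2 * c * (2 * c) * (4 * k * h * suc (h * n) ^ d)   ≡⟨ regroup c k h (suc (h * n) ^ d) ⟩
    16 * (c * c) * (k * h * suc (h * n) ^ d)          ≤⟨ *-mono-≤ (*-monoʳ-≤ 16 (*-mono-≤ c≤h c≤h))
                                                                   (*-monoʳ-≤ (k * h) ([1+hn]ᵈ≤[2h]ᵈnᵈ d h n)) ⟩
    16 * (h * h) * (k * h * ((2 * h) ^ d * n ^ d))    ≡⟨ regroup′ h k ((2 * h) ^ d) (n ^ d) ⟩
    P * n ^ d                                         ≤⟨ Pnᵈ≤s² ⟩
    s * s                                             ≤⟨ *-mono-≤ s≤2cw s≤2cw ⟩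
    2 * c * (s / c) * (2 * c * (s / c))               ≡⟨ *-interchange (2 * c) (s / c) (2 * c) (s / c) ⟩
    2 * c * (2 * c) * (s / c * (s / c))               ∎)
    where
    regroup : ∀ c k h N → 2 * c * (2 * c) * (4 * k * h * N) ≡ 16 * (c * c) * (k * h * N)
    regroup = solve-∀
    regroup′ : ∀ h k X Y → 16 * (h * h) * (k * h * (X * Y)) ≡ 16 * h * h * (k * h * X) * Y
    regroup′ = solve-∀

SupersaturationBound : (d k h j : ℕ) → Set
SupersaturationBound d k h j = Σ ℕ λ a → Σ ℕ λ b → (1 ≤ a) × (1 ≤ b) × Σ ℕ λ n₀ →
    (n : ℕ) → n₀ ≤ n →
    (A₁ A₂ : List (Vec ℕ d)) →
    Unique A₁ → Unique A₂ →
    All (InGrid n) A₁ → All (InGrid n) A₂ →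
    Disjoint A₁ A₂ →
    LogBound d k n (length A₁) → LogBound d k n (length A₂) →
    Σ ℕ λ m → fAtLeast k h j A₁ A₂ m ×
    (a * (length A₁ ^ (k * j) * length A₂ ^ (k * (h ∸ j)))
    ≤ b * n ^ (d * (k ∸ 1)) * m)

constant : (d k₀ j e : ℕ) → ℕ
constant d k₀ j e = (2 * j) ^ (k * j) * (2 * e) ^ (k * e) * (2 * (8 * (2 * h) ^ d) ^ k₀ * (k ^ h) ^ k)
  where
  k = suc k₀
  h = j + e

sizes-bound : ∀ d k₀ j e {n s₁ s₂ w₁ w₂ m} .{{_ : NonZero (j + e)}} .{{_ : NonZero n}} →
  s₁ ≤ 2 * j * w₁ → s₂ ≤ 2 * e * w₂ →
  (w₁ ^ j * w₂ ^ e) ^ suc k₀ ≤ 2 * (8 * suc ((j + e) * n) ^ d) ^ k₀ * (m * (suc k₀ ^ (j + e)) ^ suc k₀) →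
  s₁ ^ (suc k₀ * j) * s₂ ^ (suc k₀ * e) ≤ constant d k₀ j e * n ^ (d * k₀) * m
sizes-bound d k₀ j e {n} {s₁} {s₂} {w₁} {w₂} {m} s₁≤ s₂≤ rows-bound = begin
  s₁ ^ (k * j) * s₂ ^ (k * e)
    ≤⟨ *-mono-≤ (^-monoˡ-≤ (k * j) s₁≤) (^-monoˡ-≤ (k * e) s₂≤) ⟩
  (2 * j * w₁) ^ (k * j) * (2 * e * w₂) ^ (k * e)
    ≡⟨ cong₂ _*_ ([cw]^[kc] j w₁) ([cw]^[kc] e w₂) ⟩
  c * (w₁ ^ j) ^ k * (c′ * (w₂ ^ e) ^ k)
    ≡⟨ *-interchange c _ c′ _ ⟩
  c * c′ * ((w₁ ^ j) ^ k * (w₂ ^ e) ^ k)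
    ≡⟨ cong (c * c′ *_) (^-distribʳ-* (w₁ ^ j) (w₂ ^ e) k) ⟨
  c * c′ * (w₁ ^ j * w₂ ^ e) ^ k
    ≤⟨ *-monoʳ-≤ (c * c′) (≤-trans rows-bound (*-monoˡ-≤ (m * K) (*-monoʳ-≤ 2 [8N]^k₀≤))) ⟩
  c * c′ * (2 * ((8 * (2 * h) ^ d) ^ k₀ * n ^ (d * k₀)) * (m * K))
    ≡⟨ regroup (c * c′) ((8 * (2 * h) ^ d) ^ k₀) (n ^ (d * k₀)) m K ⟩
  constant d k₀ j e * n ^ (d * k₀) * m ∎
  where
  open ≤-Reasoning
  k = suc k₀
  h = j + e
  K = (k ^ h) ^ k
  c = (2 * j) ^ (k * j)
  c′ = (2 * e) ^ (k * e)
  [cw]^[kc] : ∀ c w → (2 * c * w) ^ (k * c) ≡ (2 * c) ^ (k * c) * (w ^ c) ^ k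
  [cw]^[kc] c w = trans (^-distribʳ-* (2 * c) w (k * c))
    (cong ((2 * c) ^ (k * c) *_) (trans (cong (w ^_) (*-comm k c)) (sym (^-*-assoc w c k))))
  [8N]^k₀≤ : (8 * suc (h * n) ^ d) ^ k₀ ≤ (8 * (2 * h) ^ d) ^ k₀ * n ^ (d * k₀)
  [8N]^k₀≤ = begin
    (8 * suc (h * n) ^ d) ^ k₀             ≤⟨ ^-monoˡ-≤ k₀ (*-monoʳ-≤ 8 ([1+hn]ᵈ≤[2h]ᵈnᵈ d h n)) ⟩
    (8 * ((2 * h) ^ d * n ^ d)) ^ k₀       ≡⟨ cong (_^ k₀) (*-assoc 8 ((2 * h) ^ d) (n ^ d)) ⟨
    (8 * (2 * h) ^ d * n ^ d) ^ k₀         ≡⟨ ^-distribʳ-* (8 * (2 * h) ^ d) (n ^ d) k₀ ⟩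
    (8 * (2 * h) ^ d) ^ k₀ * (n ^ d) ^ k₀  ≡⟨ cong ((8 * (2 * h) ^ d) ^ k₀ *_) (^-*-assoc n d k₀) ⟩
    (8 * (2 * h) ^ d) ^ k₀ * n ^ (d * k₀)  ∎
  regroup : ∀ c x y m K → c * (2 * (x * y) * (m * K)) ≡ c * (2 * x * K) * y * m
  regroup = solve-∀

supersaturation : ∀ d k₀ j e → 1 ≤ k₀ → 1 ≤ j → 1 ≤ e → SupersaturationBound d (suc k₀) (j + e) j
supersaturation d k₀ j e 1≤k₀ 1≤j 1≤e = 1 , suc (constant d k₀ j e) , s≤s z≤n , s≤s z≤n , suc (2 ^ P) , bound
  where
  k = suc k₀
  h = j + e
  P = threshold d k h
  bound : _
  bound n 2ᴾ<n A₁ A₂ !A₁ !A₂ A₁-grid A₂-grid A₁∩A₂=∅ large₁ large₂ = m , fAtLeast-m , (begin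
    1 * (length A₁ ^ (k * j) * length A₂ ^ (k * (h ∸ j)))
      ≡⟨ trans (*-identityˡ _) (cong (λ x → length A₁ ^ (k * j) * length A₂ ^ (k * x)) (m+n∸m≡n j e)) ⟩
    length A₁ ^ (k * j) * length A₂ ^ (k * e)
      ≤⟨ sizes-bound d k₀ j e (proj₁ (proj₂ (proj₂ block₁))) (proj₁ (proj₂ (proj₂ block₂))) rows-bound ⟩
    constant d k₀ j e * n ^ (d * k₀) * m
      ≤⟨ *-monoˡ-≤ m (*-monoˡ-≤ (n ^ (d * k₀)) (n≤1+n (constant d k₀ j e))) ⟩
    suc (constant d k₀ j e) * n ^ (d * k₀) * m ∎)
    where
    open ≤-Reasoning
    instance
      n≢0 : NonZero n
      n≢0 = >-nonZero (≤-trans (s≤s z≤n) 2ᴾ<n)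
      h≢0 : NonZero h
      h≢0 = >-nonZero (≤-trans 1≤j (m≤m+n j e))
    block₁ = blockSize d k 1≤j (m≤m+n j e) (P²nᵈ≤s² d k₀ {P} {s = length A₁} 1≤k₀ 2ᴾ<n large₁)
    block₂ = blockSize d k 1≤e (m≤n+m e j) (P²nᵈ≤s² d k₀ {P} {s = length A₂} 1≤k₀ 2ᴾ<n large₂)
    w₁ = proj₁ block₁
    w₂ = proj₁ block₂
    N≪[w₁⊓w₂]² : 4 * k * h * suc (h * n) ^ d ≤ (w₁ ⊓ w₂) * (w₁ ⊓ w₂)
    N≪[w₁⊓w₂]² with ⊓-sel w₁ w₂
    ... | inj₁ eq rewrite eq = proj₂ (proj₂ (proj₂ block₁))
    ... | inj₂ eq rewrite eq = proj₂ (proj₂ (proj₂ block₂))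
    open Construction k₀ j e !A₁ !A₂ A₁∩A₂=∅ A₁-grid A₂-grid (proj₁ (proj₂ block₁)) (proj₁ (proj₂ block₂))
      (+-mono-≤ {1} {j} {1} {e} 1≤j 1≤e) (m⊓n≤m w₁ w₂) (m⊓n≤n w₁ w₂) N≪[w₁⊓w₂]²
      using (configurations)
    m = proj₁ configurations
    fAtLeast-m = proj₁ (proj₂ configurations)
    rows-bound = proj₂ (proj₂ configurations)

lemma3p2 : (d k h j : ℕ) → 1 ≤ d → 2 ≤ k → 2 ≤ h → 1 ≤ j → j ≤ h ∸ 1 →
    Σ ℕ λ a → Σ ℕ λ b → (1 ≤ a) × (1 ≤ b) × Σ ℕ λ n₀ →
    (n : ℕ) → n₀ ≤ n →
    (A₁ A₂ : List (Vec ℕ d)) →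
    Unique A₁ → Unique A₂ →
    All (InGrid n) A₁ → All (InGrid n) A₂ →
    Disjoint A₁ A₂ →
    LogBound d k n (length A₁) → LogBound d k n (length A₂) →
    Σ ℕ λ m → fAtLeast k h j A₁ A₂ m ×
    (a * (length A₁ ^ (k * j) * length A₂ ^ (k * (h ∸ j)))
    ≤ b * n ^ (d * (k ∸ 1)) * m)
lemma3p2 d (suc k₀) h j _ (s≤s 1≤k₀) 2≤h 1≤j j≤h∸1 =
  subst (λ h′ → SupersaturationBound d (suc k₀) h′ j) (m+[n∸m]≡n j≤h) (supersaturation d k₀ j (h ∸ j) 1≤k₀ 1≤j 1≤h∸j)
  where
  j<h : j < h
  j<h = subst (_≤ h) (+-comm j 1) (m≤o∸n⇒m+n≤o j (≤-trans (s≤s z≤n) 2≤h) j≤h∸1)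
  j≤h : j ≤ h
  j≤h = <⇒≤ j<h
  1≤h∸j : 1 ≤ h ∸ j
  1≤h∸j = m<n⇒0<n∸m j<h
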